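{- Let $n\in\mathbb{N}$ with $n>1$. If $p\in\beta\mathbb{N}$ satisfies $p\star_n p=p$, then there is no $u\in\beta\mathbb{N}$ with $p=u+p$. Moreover, there are no $p,q,u\in\beta\mathbb{N}$ with $q\star_n p=p=u+p$.
   Context: $\beta\mathbb{N}$ is the set of ultrafilters on $\mathbb{N}$, with the extended addition: $B\in u+p$ iff $\{x:\{y:x+y\in B\}\in p\}\in u$. For $q,p\in\beta\mathbb{N}$, $q\star_n p$ is defined by $B\in q\star_n p$ iff $\{a\in\mathbb{N}:\{b\in\mathbb{N}:n^a b\in B\}\in p\}\in q$. -}

module Defs where

open import Level using (0ℓ)
open import Data.Nat using (ℕ; _+_; _*_; _^_; _≤_)
open import Data.Product using (_×_)
open import Data.Sum using (_⊎_)
open import Data.Unit using (⊤)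
open import Data.Empty using (⊥)
open import Relation.Nullary using (¬_)
open import Relation.Unary using (Pred; _⊆_; _∩_; ∁)
open import Function.Bundles using (_⇔_)

Subset : Set₁
Subset = Pred ℕ 0ℓ

-- Convention: the paper's ℕ is {1,2,3,...}.  We represent an ultrafilter on
-- {1,2,...} as an ultrafilter on Agda's ℕ = {0,1,...} that contains the set of
-- positive numbers (these correspond bijectively).
Positive : Subset
Positive x = 1 ≤ x

record βℕ : Set₁ where
  field
    _∈ᵤ : Subset → Set
    upward   : ∀ {A B : Subset} → A ⊆ B → A ∈ᵤ → B ∈ᵤ
    whole    : (λ (_ : ℕ) → ⊤) ∈ᵤ
    proper   : ¬ ((λ (_ : ℕ) → ⊥) ∈ᵤ)
    meet     : ∀ {A B : Subset} → A ∈ᵤ → B ∈ᵤ → (A ∩ B) ∈ᵤ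
    ultra    : ∀ (A : Subset) → A ∈ᵤ ⊎ (∁ A) ∈ᵤ
    positive : Positive ∈ᵤ

open βℕ public

_∈_ : Subset → βℕ → Set
B ∈ p = _∈ᵤ p B

_∈[_⊕_] : Subset → βℕ → βℕ → Set
B ∈[ u ⊕ p ] = (λ x → (λ y → B (x + y)) ∈ p) ∈ u

_∈[_⋆⟨_⟩_] : Subset → βℕ → ℕ → βℕ → Set
B ∈[ q ⋆⟨ n ⟩ p ] = (λ a → (λ b → B (n ^ a * b)) ∈ p) ∈ q

_≐_⊕_ : βℕ → βℕ → βℕ → Set₁
p ≐ u ⊕ p' = ∀ (B : Subset) → (B ∈ p) ⇔ (B ∈[ u ⊕ p' ])

_⋆⟨_⟩_≐_ : βℕ → ℕ → βℕ → βℕ → Set₁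
q ⋆⟨ n ⟩ p ≐ r = ∀ (B : Subset) → (B ∈[ q ⋆⟨ n ⟩ p ]) ⇔ (B ∈ r)

{-# OPTIONS --safe #-}
-- Write t z = ⌊log_n z⌋, so that t (n^a b) = a + t b, and t (x + y) = t y whenever
-- n^x ∣ y (because x < n^x).  If q ⋆ₙ p = p then every set n^k ℕ belongs to p.
-- For each a ≥ 1 colour k by the parity of ⌊k / a⌋, so that k and a + k get different
-- colours, and let C_a be the colour class of t that p contains.  If also p = u + p,
-- then p contains the set D of those z that lie in C_a whenever n^a ∣ z: for x ≥ 1,
-- translation by x maps the p-large set of multiples y of n^x lying in C_1, …, C_x
-- into D.  But q ⋆ₙ p = p then yields a ≥ 1 and b ∈ C_a with n^a b ∈ D, so that
-- t b and t (n^a b) = a + t b have the same colour, which is impossible.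
module Submission where

open import Defs
open import Data.Nat using (ℕ; zero; suc; _+_; _*_; _∸_; _^_; _/_; _≤_; _<_; s≤s⁻¹; z<s; NonZero; >-nonZero; _<?_; parity)
open import Data.Nat.Properties
open import Data.Nat.Divisibility using (_∣_; divides; quotient; quotient≢0; m∣n⇒n≡m*quotient; ∣-trans; 1∣_; m∣m*n; *-pres-∣; ∣m+n∣m⇒∣n; >⇒∤)
open import Data.Nat.DivMod using (m/n≡1+[m∸n]/n)
open import Data.Parity.Base using (Parity; 0ℙ; 1ℙ)
open import Data.Parity.Properties using (suc-homo-⁻¹; p≢p⁻¹)
open import Data.Product using (_×_; _,_; ∃; ∃-syntax; proj₁; proj₂)
open import Data.Sum using (inj₁; inj₂)
open import Data.Empty using (⊥-elim)
open import Function.Bundles using (Equivalence)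
open import Relation.Nullary using (¬_; yes; no; contradiction)
open import Relation.Unary using (Empty)
open import Relation.Binary.PropositionalEquality using (_≡_; _≢_; refl; sym; trans; cong; subst; module ≡-Reasoning)

module _ (p : βℕ) where

  ∈⇒¬Empty : ∀ {A} → A ∈ p → ¬ Empty A
  ∈⇒¬Empty A∈p A-empty = proper p (upward p (λ {z} → A-empty z) A∈p)

  ∀<-∈ : ∀ (A : ℕ → Subset) x → (∀ a → a < x → A a ∈ p) → (λ z → ∀ a → a < x → A a z) ∈ p
  ∀<-∈ A zero      _   = upward p (λ _ _ ()) (whole p)
  ∀<-∈ A (suc x) A∈p =
    upward p combine (meet p (∀<-∈ A x (λ a a<x → A∈p a (m<n⇒m<1+n a<x))) (A∈p x ≤-refl))
    where
    combine : ∀ {z} → (∀ a → a < x → A a z) × A x z → ∀ a → a < suc x → A a z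
    combine (below , at) a a<1+x with m<1+n⇒m<n∨m≡n a<1+x
    ... | inj₁ a<x  = below a a<x
    ... | inj₂ refl = at

  ultra-parity : (c : ℕ → Parity) → ∃[ π ] (λ z → c z ≡ π) ∈ p
  ultra-parity c with ultra p (λ z → c z ≡ 0ℙ)
  ... | inj₁ even∈p = 0ℙ , even∈p
  ... | inj₂ odd∈p  = 1ℙ , upward p ≢0ℙ⇒≡1ℙ odd∈p
    where
    ≢0ℙ⇒≡1ℙ : ∀ {π} → π ≢ 0ℙ → π ≡ 1ℙ
    ≢0ℙ⇒≡1ℙ {0ℙ} π≢0ℙ = contradiction refl π≢0ℙ
    ≢0ℙ⇒≡1ℙ {1ℙ} _    = refl

shifts-∈⇒∈ : ∀ u p B → p ≐ u ⊕ p → (∀ x → Positive x → (λ y → B (x + y)) ∈ p) → B ∈ p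
shifts-∈⇒∈ u p B p≐u⊕p shifts∈p =
  Equivalence.from (p≐u⊕p B) (upward u (λ {x} → shifts∈p x) (positive u))

⋆-fixed-dilates : ∀ {n} q p B → q ⋆⟨ n ⟩ p ≐ p → B ∈ p →
                  ¬ Empty (λ a → Positive a × (λ b → B (n ^ a * b)) ∈ p)
⋆-fixed-dilates q p B q⋆p≐p B∈p =
  ∈⇒¬Empty q (meet q (positive q) (Equivalence.from (q⋆p≐p B) B∈p))

⋆-fixed⇒^∣-∈ : ∀ {n} q p → q ⋆⟨ n ⟩ p ≐ p → ∀ k → (n ^ k ∣_) ∈ p
⋆-fixed⇒^∣-∈ _ p _ zero = upward p (λ {y} _ → 1∣ y) (whole p)
⋆-fixed⇒^∣-∈ {n} q p q⋆p≐p (suc k) with ultra p (n ^ suc k ∣_)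
... | inj₁ ∣∈p = ∣∈p
... | inj₂ ∤∈p = ⊥-elim (⋆-fixed-dilates q p (λ y → ¬ n ^ suc k ∣ y) q⋆p≐p ∤∈p no-dilation)
  where
  no-dilation : Empty (λ a → Positive a × (λ b → ¬ n ^ suc k ∣ n ^ a * b) ∈ p)
  no-dilation zero    (() , _)
  no-dilation (suc a) (_ , ∤∈p) = ∈⇒¬Empty p (meet p ∤∈p (⋆-fixed⇒^∣-∈ q p q⋆p≐p k)) clash
    where
    clash : Empty (λ b → ¬ n ^ suc k ∣ n ^ suc a * b × n ^ k ∣ b)
    clash b (∤ , n^k∣b) = ∤ (*-pres-∣ {o = n} (m∣m*n (n ^ a)) n^k∣b)

^-monoʳ-∣ : ∀ n {i j} → i ≤ j → n ^ i ∣ n ^ j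
^-monoʳ-∣ n {i} {j} i≤j = divides (n ^ (j ∸ i)) (begin
  n ^ j               ≡⟨ cong (n ^_) (m+[n∸m]≡n i≤j) ⟨
  n ^ (i + (j ∸ i))   ≡⟨ ^-distribˡ-+-* n i (j ∸ i) ⟩
  n ^ i * n ^ (j ∸ i) ≡⟨ *-comm (n ^ i) (n ^ (j ∸ i)) ⟩
  n ^ (j ∸ i) * n ^ i ∎)
  where open ≡-Reasoning

[n+m]/n≡1+m/n : ∀ n m .{{_ : NonZero n}} → (n + m) / n ≡ suc (m / n)
[n+m]/n≡1+m/n n m =
  trans (m/n≡1+[m∸n]/n (m≤m+n n m)) (cong (λ k → suc (k / n)) (m+n∸m≡n n m))

-- Indices are shifted by one: stripe a has width suc a, so Majority a below is the class
-- C_(a+1) above, and Typical is the set D.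
stripe : ℕ → ℕ → Parity
stripe a k = parity (k / suc a)

stripe-shift : ∀ a k → stripe a (suc a + k) ≢ stripe a k
stripe-shift a k shifted≡ = p≢p⁻¹ (parity (suc m)) (sym (trans (suc-homo-⁻¹ m) (sym parity-suc≡)))
  where
  m = k / suc a
  parity-suc≡ : parity (suc m) ≡ parity m
  parity-suc≡ = trans (cong parity (sym ([n+m]/n≡1+m/n (suc a) k))) shifted≡

module _ {n : ℕ} (1<n : 1 < n) where

  private instance
    n≢0 : NonZero n
    n≢0 = >-nonZero (m<n⇒0<n 1<n)

  a<n^a : ∀ a → a < n ^ a
  a<n^a zero    = z<s
  a<n^a (suc a) = ≤-<-trans (a<n^a a) (^-monoʳ-< n 1<n (n<1+n a))

  ^-cancelʳ-< : ∀ {i j} → n ^ i < n ^ j → i < j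
  ^-cancelʳ-< {i} {j} n^i<n^j with i <? j
  ... | yes i<j = i<j
  ... | no  i≮j = contradiction n^i<n^j (≤⇒≯ (^-monoʳ-≤ n (≮⇒≥ i≮j)))

  ⌊log⌋-exists : ∀ z → ∃[ k ] n ^ k ≤ suc z × suc z < n ^ suc k
  ⌊log⌋-exists zero = 0 , ≤-refl , ≤-trans 1<n (≤-reflexive (sym (*-identityʳ n)))
  ⌊log⌋-exists (suc z) with ⌊log⌋-exists z
  ... | k , lower , upper with suc (suc z) <? n ^ suc k
  ...   | yes below = k , m≤n⇒m≤1+n lower , below
  ...   | no  above = suc k , ≮⇒≥ above , ≤-<-trans upper (^-monoʳ-< n 1<n (n<1+n (suc k)))

  -- ⌊log⌋ 0 = 0 is a junk value.
  ⌊log⌋ : ℕ → ℕ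
  ⌊log⌋ zero    = 0
  ⌊log⌋ (suc z) = proj₁ (⌊log⌋-exists z)

  ⌊log⌋-lower : ∀ b .{{_ : NonZero b}} → n ^ ⌊log⌋ b ≤ b
  ⌊log⌋-lower (suc b) = proj₁ (proj₂ (⌊log⌋-exists b))

  ⌊log⌋-upper : ∀ b .{{_ : NonZero b}} → b < n ^ suc (⌊log⌋ b)
  ⌊log⌋-upper (suc b) = proj₂ (proj₂ (⌊log⌋-exists b))

  ⌊log⌋-unique : ∀ {k z} → n ^ k ≤ z → z < n ^ suc k → ⌊log⌋ z ≡ k
  ⌊log⌋-unique {k} {zero}  lower _     = contradiction lower (<⇒≱ (m^n>0 n k))
  ⌊log⌋-unique {k} {suc z} lower upper = ≤-antisym
    (s≤s⁻¹ (^-cancelʳ-< (≤-<-trans (⌊log⌋-lower (suc z)) upper)))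
    (s≤s⁻¹ (^-cancelʳ-< (≤-<-trans lower (⌊log⌋-upper (suc z)))))

  ⌊log⌋-+-^* : ∀ {r} a b .{{_ : NonZero b}} → r < n ^ a → ⌊log⌋ (r + n ^ a * b) ≡ a + ⌊log⌋ b
  ⌊log⌋-+-^* {r} a b r<n^a = ⌊log⌋-unique lower upper
    where
    open ≤-Reasoning
    k = ⌊log⌋ b
    lower : n ^ (a + k) ≤ r + n ^ a * b
    lower = begin
      n ^ (a + k)   ≡⟨ ^-distribˡ-+-* n a k ⟩
      n ^ a * n ^ k ≤⟨ *-monoʳ-≤ (n ^ a) (⌊log⌋-lower b) ⟩
      n ^ a * b     ≤⟨ m≤n+m (n ^ a * b) r ⟩
      r + n ^ a * b ∎
    upper : r + n ^ a * b < n ^ suc (a + k)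
    upper = begin-strict
      r + n ^ a * b       <⟨ +-monoˡ-< (n ^ a * b) r<n^a ⟩
      n ^ a + n ^ a * b   ≡⟨ *-suc (n ^ a) b ⟨
      n ^ a * suc b       ≤⟨ *-monoʳ-≤ (n ^ a) (⌊log⌋-upper b) ⟩
      n ^ a * n ^ suc k   ≡⟨ ^-distribˡ-+-* n a (suc k) ⟨
      n ^ (a + suc k)     ≡⟨ cong (n ^_) (+-suc a k) ⟩
      n ^ suc (a + k)     ∎

  ⌊log⌋-^* : ∀ a b .{{_ : NonZero b}} → ⌊log⌋ (n ^ a * b) ≡ a + ⌊log⌋ b
  ⌊log⌋-^* a b = ⌊log⌋-+-^* a b (m^n>0 n a)

  ⌊log⌋-+-absorb : ∀ {r a y} .{{_ : NonZero y}} → r < n ^ a → n ^ a ∣ y → ⌊log⌋ (r + y) ≡ ⌊log⌋ y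
  ⌊log⌋-+-absorb {r} {a} {y} r<n^a n^a∣y = begin
    ⌊log⌋ (r + y)         ≡⟨ cong (λ y → ⌊log⌋ (r + y)) y≡n^a*c ⟩
    ⌊log⌋ (r + n ^ a * c) ≡⟨ ⌊log⌋-+-^* a c r<n^a ⟩
    a + ⌊log⌋ c           ≡⟨ ⌊log⌋-^* a c ⟨
    ⌊log⌋ (n ^ a * c)     ≡⟨ cong ⌊log⌋ y≡n^a*c ⟨
    ⌊log⌋ y               ∎
    where
    open ≡-Reasoning
    c = quotient n^a∣y
    instance
      c≢0 : NonZero c
      c≢0 = quotient≢0 n^a∣y
    y≡n^a*c : y ≡ n ^ a * c
    y≡n^a*c = m∣n⇒n≡m*quotient n^a∣y

  n^[1+a]∣x+y⇒a<x : ∀ {a x y} .{{_ : NonZero x}} → n ^ x ∣ y → n ^ suc a ∣ x + y → a < x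
  n^[1+a]∣x+y⇒a<x {a} {x} {y} n^x∣y n^[1+a]∣x+y with a <? x
  ... | yes a<x = a<x
  ... | no  a≮x = contradiction n^x∣x (>⇒∤ (a<n^a x))
    where
    n^x∣y+x : n ^ x ∣ y + x
    n^x∣y+x = subst (n ^ x ∣_) (+-comm x y)
      (∣-trans (^-monoʳ-∣ n (m≤n⇒m≤1+n (≮⇒≥ a≮x))) n^[1+a]∣x+y)
    n^x∣x : n ^ x ∣ x
    n^x∣x = ∣m+n∣m⇒∣n n^x∣y+x n^x∣y

  module _ (p : βℕ) where

    majority : ℕ → Parity
    majority a = proj₁ (ultra-parity p (λ z → stripe a (⌊log⌋ z)))

    Majority : ℕ → Subset
    Majority a z = stripe a (⌊log⌋ z) ≡ majority a

    Majority-∈ : ∀ a → Majority a ∈ p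
    Majority-∈ a = proj₂ (ultra-parity p (λ z → stripe a (⌊log⌋ z)))

    Majority-dilation : ∀ a b .{{_ : NonZero b}} → Majority a b → ¬ Majority a (n ^ suc a * b)
    Majority-dilation a b b∈C n^[1+a]b∈C = stripe-shift a (⌊log⌋ b) (begin
      stripe a (suc a + ⌊log⌋ b)        ≡⟨ cong (stripe a) (⌊log⌋-^* (suc a) b) ⟨
      stripe a (⌊log⌋ (n ^ suc a * b))  ≡⟨ n^[1+a]b∈C ⟩
      majority a                        ≡⟨ b∈C ⟨
      stripe a (⌊log⌋ b)                ∎)
      where open ≡-Reasoning

    Typical : Subset
    Typical z = ∀ a → n ^ suc a ∣ z → Majority a z

    Typical-shift : ∀ x y .{{_ : NonZero x}} .{{_ : NonZero y}} → n ^ x ∣ y →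
                    (∀ a → a < x → Majority a y) → Typical (x + y)
    Typical-shift x y n^x∣y y∈C a n^[1+a]∣x+y =
      subst (_≡ majority a) (cong (stripe a) (sym (⌊log⌋-+-absorb {a = x} (a<n^a x) n^x∣y)))
        (y∈C a (n^[1+a]∣x+y⇒a<x n^x∣y n^[1+a]∣x+y))

    Typical-∈ : ∀ u → (∀ k → (n ^ k ∣_) ∈ p) → p ≐ u ⊕ p → Typical ∈ p
    Typical-∈ u n^k∣-∈ p≐u⊕p = shifts-∈⇒∈ u p Typical p≐u⊕p shift-∈
      where
      shift-∈ : ∀ x → Positive x → (λ y → Typical (x + y)) ∈ p
      shift-∈ x@(suc _) _ = upward p (λ {y} → shifted y)
        (meet p (meet p (n^k∣-∈ x) (positive p)) (∀<-∈ p Majority x (λ a _ → Majority-∈ a)))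
        where
        shifted : ∀ y → (n ^ x ∣ y × Positive y) × (∀ a → a < x → Majority a y) → Typical (x + y)
        shifted y@(suc _) ((n^x∣y , _) , y∈C) = Typical-shift x y n^x∣y y∈C

    Typical-∉ : ∀ q → q ⋆⟨ n ⟩ p ≐ p → ¬ Typical ∈ p
    Typical-∉ q q⋆p≐p Typical∈p = ⋆-fixed-dilates q p Typical q⋆p≐p Typical∈p no-dilation
      where
      no-dilation : Empty (λ a → Positive a × (λ b → Typical (n ^ a * b)) ∈ p)
      no-dilation zero    (() , _)
      no-dilation (suc a) (_ , dilated∈p) =
        ∈⇒¬Empty p (meet p (meet p dilated∈p (positive p)) (Majority-∈ a)) clash
        where
        clash : Empty (λ b → (Typical (n ^ suc a * b) × Positive b) × Majority a b)
        clash b@(suc _) ((typical , _) , b∈C) = Majority-dilation a b b∈C (typical a (m∣m*n b))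

⋆-fixed-⊕-fixed-absurd : ∀ {n} → 1 < n → (p q u : βℕ) → q ⋆⟨ n ⟩ p ≐ p → ¬ (p ≐ u ⊕ p)
⋆-fixed-⊕-fixed-absurd 1<n p q u q⋆p≐p p≐u⊕p =
  Typical-∉ 1<n p q q⋆p≐p (Typical-∈ 1<n p u (⋆-fixed⇒^∣-∈ q p q⋆p≐p) p≐u⊕p)

lemma3p2 : (n : ℕ) → 1 < n →
    ((p : βℕ) → p ⋆⟨ n ⟩ p ≐ p → ¬ ∃ (λ (u : βℕ) → p ≐ u ⊕ p))
    × ((p q u : βℕ) → ¬ ((q ⋆⟨ n ⟩ p ≐ p) × (p ≐ u ⊕ p)))
lemma3p2 n 1<n =
  (λ p p⋆p≐p (u , p≐u⊕p) → ⋆-fixed-⊕-fixed-absurd 1<n p p u p⋆p≐p p≐u⊕p) ,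
  (λ p q u (q⋆p≐p , p≐u⊕p) → ⋆-fixed-⊕-fixed-absurd 1<n p q u q⋆p≐p p≐u⊕p)
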